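{- Let $G_1,\dots,G_n$ ($n\ge2$) be games each of which is both miserable and returnable. Then their disjunctive sum $G_1+\dots+G_n$ is returnable.
   Context: A game is a two-player impartial game given by a directed acyclic graph whose vertices are positions and whose arcs are moves, such that from every position only finitely many positions are reachable. A position with no moves is terminal. $\operatorname{mex}(S)$ is the least non-negative integer not in $S$. The normal Sprague–Grundy function is $\mathcal{G}(x)=\operatorname{mex}\{\mathcal{G}(y): x\to y\}$ (so $0$ on terminal positions); the misère Sprague–Grundy function $\mathcal{G}^-$ satisfies $\mathcal{G}^-(x)=1$ for terminal $x$ and $\mathcal{G}^-(x)=\operatorname{mex}\{\mathcal{G}^-(y): x\to y\}$ otherwise. An $(i,j)$-position is a position $x$ with $\mathcal{G}(x)=i$, $\mathcal{G}^-(x)=j$, and $V_{i,j}$ the set of them. A position $x$ is movable to a set $W$ if there is a move from $x$ to some position of $W$. A game is miserable if every position $x$ satisfies at least one of: (a) $x\in V_{0,1}\cup V_{1,0}$; (b) $x$ is not movable to $V_{0,1}\cup V_{1,0}$; (c) $x$ is movable to $V_{0,1}$ and to $V_{1,0}$. A game is returnable if whenever $x$ is a $(0,1)$-position (resp. $(1,0)$-position) and $x\to y$ is a move to a non-terminal position $y$, then $y$ has a move to a $(0,1)$-position (resp. $(1,0)$-position). The disjunctive sum has positions $(x_1,\dots,x_n)$, $x_i$ a position of $G_i$, and a move consists of making a move in exactly one coordinate; $\mathcal{G},\mathcal{G}^-$ of the sum are computed in the sum itself. -}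

module Defs where

open import Level using (Level; suc; _⊔_)
open import Data.Nat using (ℕ; _<_; _≥_)
open import Data.Fin using (Fin; _≟_)
open import Data.List using (List; []; map; concatMap; allFin)
open import Data.List.Membership.Propositional using (_∈_; _∉_)
open import Data.List.Relation.Binary.Pointwise using (Pointwise)
open import Data.Product using (Σ; ∃; _×_; _,_)
open import Data.Sum using (_⊎_)
open import Relation.Nullary using (¬_; yes; no)
open import Relation.Binary.PropositionalEquality using (_≡_; _≢_; refl)
open import Induction.WellFounded using (WellFounded)

record Arena : Set₁ where
  field
    Pos   : Set
    moves : Pos → List Pos

  _⇒_ : Pos → Pos → Set
  x ⇒ y = y ∈ moves x

  Terminal : Pos → Set
  Terminal x = moves x ≡ []

-- A game: an arena whose move relation is well-founded (no infinite play, hence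
-- acyclic); together with finite branching this gives that from every position
-- only finitely many positions are reachable.
record Game : Set₁ where
  field
    arena : Arena
  open Arena arena public
  field
    wf : WellFounded (λ y x → x ⇒ y)

IsMex : List ℕ → ℕ → Set
IsMex S k = (k ∉ S) × (∀ j → j < k → j ∈ S)

module _ (A : Arena) where
  open Arena A

  -- normal Sprague–Grundy value:  HasG x k  ⇔  𝒢(x) = k
  data HasG : Pos → ℕ → Set where
    hasG : ∀ {x k} (vs : List ℕ) → Pointwise HasG (moves x) vs → IsMex vs k → HasG x k

  -- misère Sprague–Grundy value:  HasG⁻ x k  ⇔  𝒢⁻(x) = k
  data HasG⁻ : Pos → ℕ → Set where
    term⁻ : ∀ {x} → Terminal x → HasG⁻ x 1
    hasG⁻ : ∀ {x k} → ¬ Terminal x → (vs : List ℕ) → Pointwise HasG⁻ (moves x) vs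
          → IsMex vs k → HasG⁻ x k

  V : ℕ → ℕ → Pos → Set
  V i j x = HasG x i × HasG⁻ x j

  MovableTo : Pos → (Pos → Set) → Set
  MovableTo x W = ∃ λ y → (x ⇒ y) × W y

  V01∪V10 : Pos → Set
  V01∪V10 x = V 0 1 x ⊎ V 1 0 x

  Miserable : Set
  Miserable = ∀ x → V01∪V10 x
                  ⊎ (¬ MovableTo x V01∪V10)
                  ⊎ (MovableTo x (V 0 1) × MovableTo x (V 1 0))

  Returnable : Set
  Returnable = ∀ x y → x ⇒ y → ¬ Terminal y →
                 (V 0 1 x → MovableTo y (V 0 1)) × (V 1 0 x → MovableTo y (V 1 0))

update : ∀ {n} {P : Fin n → Set} → ((j : Fin n) → P j) → (i : Fin n) → P i → (j : Fin n) → P j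
update x i y j with i ≟ j
... | yes refl = y
... | no _ = x j

Sum : ∀ {n} → (Fin n → Game) → Arena
Sum {n} G = record
  { Pos   = (i : Fin n) → Game.Pos (G i)
  ; moves = λ x → concatMap (λ i → map (update x i) (Game.moves (G i) (x i))) (allFin n)
  }

MiserableG : Game → Set
MiserableG G = Miserable (Game.arena G)

ReturnableG : Game → Set
ReturnableG G = Returnable (Game.arena G)

-- Call a position special, with bit b, if it is a (b, 1 - b)-position.  In a miserable game a
-- non-special position has 𝒢⁻ = 𝒢, because the normal and misère values of its options can be
-- paired off, and a special non-terminal position can move to a special position of the other
-- bit; returnability lets a move from a special to a non-special position be answered by a move
-- back to a special position of the original bit.
-- In the sum, a position all of whose components are special is special with bit the parity of
-- the component bits, and every other position has 𝒢⁻ = 𝒢: the two claims are proved together,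
-- by an induction that looks two moves ahead.  So a (0,1)- or (1,0)-position of the sum has only
-- special components, and after a move in component i its bit is restored either by moving
-- component i back to a special position, if it became non-special, or else, the move having
-- flipped the parity, by any further move between special positions.

module Submission where

open import Defs
open import Level using (0ℓ)
open import Data.Bool using (Bool; true; false; not; _xor_)
open import Data.Bool.Properties using (not-involutive; not-distribˡ-xor; not-distribʳ-xor)
open import Data.Empty using (⊥-elim)
open import Data.Fin as Fin using (Fin; fromℕ; fromℕ<) renaming (zero to fzero; suc to fsuc)
open import Data.Fin.Properties
  using (¬∀⟶∃¬-smallest; toℕ-fromℕ; toℕ-fromℕ<; toℕ-inject; suc-injective; all?)
open import Data.List using (List; []; _∷_; map; allFin)
open import Data.List.Membership.Propositional using (_∈_; _∉_; lose)
open import Data.List.Membership.Propositional.Properties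
  using (∈-map⁺; ∈-map⁻; ∈-concatMap⁺; ∈-concatMap⁻; ∈-allFin)
open import Data.List.Relation.Unary.Any using (here; there; satisfied)
open import Data.List.Relation.Binary.Pointwise using (Pointwise; []; _∷_)
open import Data.Nat using (ℕ; zero; suc; _+_; _⊔_; _<_; _≤_; _≥_; _≡ᵇ_; _≟_; z≤n; s≤s)
open import Data.Nat.Induction using (<-wellFounded)
open import Data.Nat.ListAction using (sum)
open import Data.Nat.Properties
  using ( <-cmp; ≤-refl; ≤-reflexive; ≤-trans; 1+n≰n; m≤m+n; m≤n+m; m≤m⊔n; m≤n⊔m
        ; +-mono-<-≤; +-mono-≤-<)
open import Data.List.Membership.DecPropositional _≟_ using (_∈?_)
open import Data.Product using (∃; ∃₂; _×_; _,_; proj₁; proj₂; map₂)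
open import Data.Sum using (_⊎_; inj₁; inj₂) renaming (map to map-⊎)
open import Function using (_∘_)
open import Induction.WellFounded using (Acc; acc; WellFounded; module All)
open import Relation.Binary using (tri<; tri≈; tri>)
open import Relation.Binary.PropositionalEquality
  using (_≡_; _≢_; _≗_; refl; sym; trans; cong; cong₂; subst; module ≡-Reasoning)
open import Relation.Nullary using (¬_; Dec; yes; no)
open import Relation.Nullary.Decidable using (_×-dec_; map′)

toℕ : Bool → ℕ
toℕ false = 0
toℕ true  = 1

toℕ-not-≢ : ∀ b → toℕ (not b) ≢ toℕ b
toℕ-not-≢ true  ()
toℕ-not-≢ false ()

<toℕ⇒≡toℕ-not : ∀ {j} b → j < toℕ b → j ≡ toℕ (not b)
<toℕ⇒≡toℕ-not true  (s≤s z≤n) = refl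

∈⇒≢[] : ∀ {A : Set} {a : A} {l} → a ∈ l → l ≢ []
∈⇒≢[] a∈l refl with () ← a∈l

pointwise-choice : ∀ {A B : Set} {R : A → B → Set} (l : List A) →
                   (∀ {a} → a ∈ l → ∃ (R a)) → ∃ (Pointwise R l)
pointwise-choice []      choose = [] , []
pointwise-choice (a ∷ l) choose with choose (here refl) | pointwise-choice l (choose ∘ there)
... | b , r | bs , rs = b ∷ bs , r ∷ rs

pointwise-graph : ∀ {A B : Set} {R : A → B → Set} (f : A → B) → (∀ {a b} → R a b → f a ≡ b) →
                  ∀ {l bs} → Pointwise R l bs → map f l ≡ bs
pointwise-graph f graph []       = refl
pointwise-graph f graph (r ∷ rs) = cong₂ _∷_ (graph r) (pointwise-graph f graph rs)

∈⇒≤sum : ∀ {j S} → j ∈ S → j ≤ sum S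
∈⇒≤sum {S = s ∷ S} (here refl)  = m≤m+n s (sum S)
∈⇒≤sum {S = s ∷ S} (there j∈S) = ≤-trans (∈⇒≤sum j∈S) (m≤n+m (sum S) s)

1+sum∉ : ∀ S → suc (sum S) ∉ S
1+sum∉ S = 1+n≰n ∘ ∈⇒≤sum

mex-exists : ∀ S → ∃ (IsMex S)
mex-exists S
  with k , k∉S , below∈S ← ¬∀⟶∃¬-smallest (2 + sum S) (λ k → Fin.toℕ k ∈ S) (λ k → Fin.toℕ k ∈? S)
                             (λ all∈ → 1+sum∉ S (subst (_∈ S) (toℕ-fromℕ _) (all∈ (fromℕ (suc (sum S))))))
  = Fin.toℕ k , k∉S , λ j j<k →
      subst (_∈ S) (trans (toℕ-inject (fromℕ< j<k)) (toℕ-fromℕ< j<k)) (below∈S (fromℕ< j<k))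

IsMex-unique : ∀ {S k k′} → IsMex S k → IsMex S k′ → k ≡ k′
IsMex-unique {k = k} {k′} (k∉ , below) (k′∉ , below′) with <-cmp k k′
... | tri< k<k′ _ _ = ⊥-elim (k∉ (below′ k k<k′))
... | tri≈ _ k≡k′ _ = k≡k′
... | tri> _ _ k′<k = ⊥-elim (k′∉ (below k′ k′<k))

module _ {n} {P : Fin n → Set} (x : (j : Fin n) → P j) where

  update-same : ∀ i (w : P i) → update x i w i ≡ w
  update-same i w with i Fin.≟ i
  ... | yes refl = refl
  ... | no i≢i   = ⊥-elim (i≢i refl)

  update-other : ∀ {i j} (w : P i) → i ≢ j → update x i w j ≡ x j
  update-other {i} {j} w i≢j with i Fin.≟ j
  ... | yes i≡j = ⊥-elim (i≢j i≡j)
  ... | no _    = refl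

parity : ∀ {n} → (Fin n → Bool) → Bool
parity {zero}  β = false
parity {suc n} β = β fzero xor parity (β ∘ fsuc)

parity-cong : ∀ {n} {β γ : Fin n → Bool} → β ≗ γ → parity β ≡ parity γ
parity-cong {zero}  β≗γ = refl
parity-cong {suc n} β≗γ = cong₂ _xor_ (β≗γ fzero) (parity-cong (β≗γ ∘ fsuc))

parity-false : ∀ {n} {β : Fin n → Bool} → (∀ i → β i ≡ false) → parity β ≡ false
parity-false {zero}      β≡false = refl
parity-false {suc n} {β} β≡false rewrite β≡false fzero = parity-false (β≡false ∘ fsuc)

parity-flip : ∀ {n} {β γ : Fin n → Bool} i → (∀ j → i ≢ j → γ j ≡ β j) → γ i ≡ not (β i) →
              parity γ ≡ not (parity β)
parity-flip {suc n} {β} {γ} fzero γ≡β γ₀ = begin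
  γ fzero xor parity (γ ∘ fsuc)      ≡⟨ cong₂ _xor_ γ₀ (parity-cong (λ j → γ≡β (fsuc j) λ ())) ⟩
  not (β fzero) xor parity (β ∘ fsuc) ≡⟨ not-distribˡ-xor (β fzero) _ ⟨
  not (parity β)                       ∎
  where open ≡-Reasoning
parity-flip {suc n} {β} {γ} (fsuc i) γ≡β γᵢ = begin
  γ fzero xor parity (γ ∘ fsuc)       ≡⟨ cong₂ _xor_ (γ≡β fzero λ ()) tail-flips ⟩
  β fzero xor not (parity (β ∘ fsuc)) ≡⟨ not-distribʳ-xor (β fzero) _ ⟨
  not (parity β)                        ∎
  where
  open ≡-Reasoning
  tail-flips : parity (γ ∘ fsuc) ≡ not (parity (β ∘ fsuc))
  tail-flips = parity-flip i (λ j i≢j → γ≡β (fsuc j) (i≢j ∘ suc-injective)) γᵢ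

sumᶠ : ∀ {n} → (Fin n → ℕ) → ℕ
sumᶠ {zero}  b = 0
sumᶠ {suc n} b = b fzero + sumᶠ (b ∘ fsuc)

sumᶠ-cong : ∀ {n} {b c : Fin n → ℕ} → b ≗ c → sumᶠ b ≡ sumᶠ c
sumᶠ-cong {zero}  b≗c = refl
sumᶠ-cong {suc n} b≗c = cong₂ _+_ (b≗c fzero) (sumᶠ-cong (b≗c ∘ fsuc))

sumᶠ-decrease : ∀ {n} {b c : Fin n → ℕ} i → (∀ j → i ≢ j → c j ≡ b j) → c i < b i → sumᶠ c < sumᶠ b
sumᶠ-decrease {suc n} fzero c≡b c₀<b₀ =
  +-mono-<-≤ c₀<b₀ (≤-reflexive (sumᶠ-cong λ j → c≡b (fsuc j) λ ()))
sumᶠ-decrease {suc n} (fsuc i) c≡b cᵢ<bᵢ =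
  +-mono-≤-< (≤-reflexive (c≡b fzero λ ()))
             (sumᶠ-decrease i (λ j i≢j → c≡b (fsuc j) (i≢j ∘ suc-injective)) cᵢ<bᵢ)

module Positions (Γ : Game) where
  open Game Γ

  open All wf 0ℓ public using () renaming (wfRec to induction)

  induction₂ : (P : Pos → Set) →
               (∀ x → (∀ {y} → x ⇒ y → P y) → (∀ {y z} → x ⇒ y → y ⇒ z → P z) → P x) →
               ∀ x → P x
  induction₂ P step x = proj₁ (induction P-here-and-next step₂ x)
    where
    P-here-and-next : Pos → Set
    P-here-and-next x = P x × (∀ {y} → x ⇒ y → P y)
    step₂ : ∀ x → (∀ {y} → x ⇒ y → P-here-and-next y) → P-here-and-next x
    step₂ x ih = step x (proj₁ ∘ ih) (λ x⇒y → proj₂ (ih x⇒y)) , proj₁ ∘ ih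

  terminal? : ∀ x → Dec (Terminal x)
  terminal? x with moves x
  ... | []    = yes refl
  ... | _ ∷ _ = no λ ()

  ¬Terminal⇒move : ∀ {x} → ¬ Terminal x → ∃ (x ⇒_)
  ¬Terminal⇒move {x} ¬t with moves x
  ... | []    = ⊥-elim (¬t refl)
  ... | y ∷ _ = y , here refl

  Bounded : ℕ → Pos → Set
  Bounded zero    x = ∀ {y} → ¬ x ⇒ y
  Bounded (suc k) x = ∀ {y} → x ⇒ y → Bounded k y

  Bounded-mono : ∀ {k m x} → k ≤ m → Bounded k x → Bounded m x
  Bounded-mono {zero}  {zero}  _         bounded     = bounded
  Bounded-mono {zero}  {suc m} _         bounded x⇒y = ⊥-elim (bounded x⇒y)
  Bounded-mono {suc k} {suc m} (s≤s k≤m) bounded x⇒y = Bounded-mono k≤m (bounded x⇒y)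

  bounded-all : (l : List Pos) → (∀ {y} → y ∈ l → ∃ λ k → Bounded k y) →
                ∃ λ k → ∀ {y} → y ∈ l → Bounded k y
  bounded-all []      bound = 0 , λ ()
  bounded-all (y ∷ l) bound with bound (here refl) | bounded-all l (bound ∘ there)
  ... | k , bounded-y | m , bounded-l = k ⊔ m , λ where
    (here refl) → Bounded-mono (m≤m⊔n k m) bounded-y
    (there y∈l) → Bounded-mono (m≤n⊔m k m) (bounded-l y∈l)

  bounded : ∀ x → ∃ λ k → Bounded k x
  bounded = induction _ λ x ih → let k , bounded-options = bounded-all (moves x) ih in suc k , bounded-options

module SpragueGrundy (Γ : Game) where
  open Game Γ
  open Positions Γ public

  mutual
    HasG-unique : ∀ {x k k′} → HasG arena x k → HasG arena x k′ → k ≡ k′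
    HasG-unique (hasG vs ps mex) (hasG vs′ ps′ mex′) with Pointwise-HasG-unique ps ps′
    ... | refl = IsMex-unique mex mex′

    Pointwise-HasG-unique : ∀ {l vs vs′} → Pointwise (HasG arena) l vs → Pointwise (HasG arena) l vs′ →
                            vs ≡ vs′
    Pointwise-HasG-unique []       []         = refl
    Pointwise-HasG-unique (p ∷ ps) (p′ ∷ ps′) =
      cong₂ _∷_ (HasG-unique p p′) (Pointwise-HasG-unique ps ps′)

  mutual
    HasG⁻-unique : ∀ {x k k′} → HasG⁻ arena x k → HasG⁻ arena x k′ → k ≡ k′
    HasG⁻-unique (term⁻ _)          (term⁻ _)             = refl
    HasG⁻-unique (term⁻ t)          (hasG⁻ ¬t _ _ _)      = ⊥-elim (¬t t)
    HasG⁻-unique (hasG⁻ ¬t _ _ _)   (term⁻ t)             = ⊥-elim (¬t t)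
    HasG⁻-unique (hasG⁻ _ vs ps mex) (hasG⁻ _ vs′ ps′ mex′) with Pointwise-HasG⁻-unique ps ps′
    ... | refl = IsMex-unique mex mex′

    Pointwise-HasG⁻-unique : ∀ {l vs vs′} → Pointwise (HasG⁻ arena) l vs → Pointwise (HasG⁻ arena) l vs′ →
                             vs ≡ vs′
    Pointwise-HasG⁻-unique []       []         = refl
    Pointwise-HasG⁻-unique (p ∷ ps) (p′ ∷ ps′) =
      cong₂ _∷_ (HasG⁻-unique p p′) (Pointwise-HasG⁻-unique ps ps′)

  HasG-exists : ∀ x → ∃ (HasG arena x)
  HasG-exists = induction _ λ x ih →
    let vs , ps = pointwise-choice (moves x) ih ; k , mex = mex-exists vs in k , hasG vs ps mex

  HasG⁻-exists : ∀ x → ∃ (HasG⁻ arena x)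
  HasG⁻-exists = induction _ step
    where
    step : ∀ x → (∀ {y} → x ⇒ y → ∃ (HasG⁻ arena y)) → ∃ (HasG⁻ arena x)
    step x ih with terminal? x
    ... | yes t  = 1 , term⁻ t
    ... | no ¬t = let vs , ps = pointwise-choice (moves x) ih ; k , mex = mex-exists vs in
                  k , hasG⁻ ¬t vs ps mex

  opaque
    𝒢 : Pos → ℕ
    𝒢 x = proj₁ (HasG-exists x)

    𝒢⁻ : Pos → ℕ
    𝒢⁻ x = proj₁ (HasG⁻-exists x)

    HasG-𝒢 : ∀ x → HasG arena x (𝒢 x)
    HasG-𝒢 x = proj₂ (HasG-exists x)

    HasG⁻-𝒢⁻ : ∀ x → HasG⁻ arena x (𝒢⁻ x)
    HasG⁻-𝒢⁻ x = proj₂ (HasG⁻-exists x)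

  HasG⇒𝒢≡ : ∀ {x k} → HasG arena x k → 𝒢 x ≡ k
  HasG⇒𝒢≡ = HasG-unique (HasG-𝒢 _)

  HasG⁻⇒𝒢⁻≡ : ∀ {x k} → HasG⁻ arena x k → 𝒢⁻ x ≡ k
  HasG⁻⇒𝒢⁻≡ = HasG⁻-unique (HasG⁻-𝒢⁻ _)

  HasG⇒mex : ∀ {x k} → HasG arena x k → IsMex (map 𝒢 (moves x)) k
  HasG⇒mex (hasG vs ps mex) = subst (λ ws → IsMex ws _) (sym (pointwise-graph 𝒢 HasG⇒𝒢≡ ps)) mex

  HasG⁻⇒mex : ∀ {x k} → ¬ Terminal x → HasG⁻ arena x k → IsMex (map 𝒢⁻ (moves x)) k
  HasG⁻⇒mex ¬t (term⁻ t)            = ⊥-elim (¬t t)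
  HasG⁻⇒mex _  (hasG⁻ _ vs ps mex) =
    subst (λ ws → IsMex ws _) (sym (pointwise-graph 𝒢⁻ HasG⁻⇒𝒢⁻≡ ps)) mex

  𝒢-mex : ∀ x → IsMex (map 𝒢 (moves x)) (𝒢 x)
  𝒢-mex x = HasG⇒mex (HasG-𝒢 x)

  𝒢⁻-mex : ∀ {x} → ¬ Terminal x → IsMex (map 𝒢⁻ (moves x)) (𝒢⁻ x)
  𝒢⁻-mex ¬t = HasG⁻⇒mex ¬t (HasG⁻-𝒢⁻ _)

  mex-excludes : ∀ {f x y k} → IsMex (map f (moves x)) k → x ⇒ y → f y ≢ k
  mex-excludes {f} (k∉ , _) x⇒y fy≡k = k∉ (subst (_∈ _) fy≡k (∈-map⁺ f x⇒y))

  mex-attains : ∀ {f x j k} → IsMex (map f (moves x)) k → j < k → ∃ λ y → x ⇒ y × f y ≡ j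
  mex-attains {f} (_ , below) j<k with ∈-map⁻ f (below _ j<k)
  ... | y , x⇒y , j≡fy = y , x⇒y , sym j≡fy

  𝒢-option : ∀ {x y} → x ⇒ y → 𝒢 y ≢ 𝒢 x
  𝒢-option = mex-excludes (𝒢-mex _)

  -- Special false and Special true are V₀₁ and V₁₀.
  Special : Bool → Pos → Set
  Special b x = 𝒢 x ≡ toℕ b × 𝒢⁻ x ≡ toℕ (not b)

  IsSpecial : Pos → Set
  IsSpecial x = ∃ λ b → Special b x

  bit : Pos → Bool
  bit x = 𝒢 x ≡ᵇ 1

  Special⇒bit : ∀ {b x} → Special b x → bit x ≡ b
  Special⇒bit {false} (𝒢x≡0 , _) = cong (_≡ᵇ 1) 𝒢x≡0
  Special⇒bit {true}  (𝒢x≡1 , _) = cong (_≡ᵇ 1) 𝒢x≡1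

  special? : ∀ x → Dec (IsSpecial x)
  special? x = map′ (bit x ,_) (λ (b , s) → subst (λ b → Special b x) (sym (Special⇒bit s)) s)
                    ((𝒢 x ≟ toℕ (bit x)) ×-dec (𝒢⁻ x ≟ toℕ (not (bit x))))

  V⇒Special : ∀ b {x} → V arena (toℕ b) (toℕ (not b)) x → Special b x
  V⇒Special _ (g , g⁻) = HasG⇒𝒢≡ g , HasG⁻⇒𝒢⁻≡ g⁻

  Special⇒V : ∀ {b x} → Special b x → V arena (toℕ b) (toℕ (not b)) x
  Special⇒V {x = x} (g , g⁻) = subst (HasG arena x) g (HasG-𝒢 x) , subst (HasG⁻ arena x) g⁻ (HasG⁻-𝒢⁻ x)

  V₀₁∪V₁₀⇒IsSpecial : ∀ {x} → V01∪V10 arena x → IsSpecial x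
  V₀₁∪V₁₀⇒IsSpecial (inj₁ v) = false , V⇒Special false v
  V₀₁∪V₁₀⇒IsSpecial (inj₂ v) = true  , V⇒Special true v

  IsSpecial⇒V₀₁∪V₁₀ : ∀ {x} → IsSpecial x → V01∪V10 arena x
  IsSpecial⇒V₀₁∪V₁₀ (false , s) = inj₁ (Special⇒V s)
  IsSpecial⇒V₀₁∪V₁₀ (true  , s) = inj₂ (Special⇒V s)

  terminal-special : ∀ {x} → Terminal x → Special false x
  terminal-special t = HasG⇒𝒢≡ (hasG [] no-options ((λ ()) , λ _ ())) , HasG⁻⇒𝒢⁻≡ (term⁻ t)
    where no-options = subst (λ l → Pointwise (HasG arena) l []) (sym t) []

  Special-unique : ∀ {b b′ x} → Special b x → Special b′ x → b ≡ b′
  Special-unique s s′ = trans (sym (Special⇒bit s)) (Special⇒bit s′)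

  special-move-flips : ∀ {b b′ x y} → Special b x → x ⇒ y → Special b′ y → b′ ≡ not b
  special-move-flips {false} {false} (g , _) x⇒y (g′ , _) = ⊥-elim (𝒢-option x⇒y (trans g′ (sym g)))
  special-move-flips {false} {true}  _       _   _        = refl
  special-move-flips {true}  {false} _       _   _        = refl
  special-move-flips {true}  {true}  (g , _) x⇒y (g′ , _) = ⊥-elim (𝒢-option x⇒y (trans g′ (sym g)))

  Special-swapped : ∀ {b y y′} → Special b y → Special (not b) y′ → 𝒢 y′ ≡ 𝒢⁻ y × 𝒢⁻ y′ ≡ 𝒢 y
  Special-swapped {b} (g , g⁻) (g′ , g⁻′) =
    trans g′ (sym g⁻) , trans g⁻′ (trans (cong toℕ (not-involutive b)) (sym g))

  value-from-options : (f : Pos → ℕ) → (∀ {x} → ¬ Terminal x → IsMex (map f (moves x)) (f x)) →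
    ∀ {x} b → ¬ Terminal x → (∃ λ y → x ⇒ y × f y ≡ toℕ (not b)) →
    (∀ {y} → x ⇒ y → f y ≡ toℕ (not b) ⊎ ∃ λ z → y ⇒ z × f z ≡ toℕ b) →
    f x ≡ toℕ b
  value-from-options f f-mex {x} b ¬t (y₀ , x⇒y₀ , fy₀) options =
    IsMex-unique (f-mex ¬t) (absent , below)
    where
    absent : toℕ b ∉ map f (moves x)
    absent b∈ with ∈-map⁻ f b∈
    ... | y , x⇒y , b≡fy with options x⇒y
    ...   | inj₁ fy≡¬b             = toℕ-not-≢ b (trans (sym fy≡¬b) (sym b≡fy))
    ...   | inj₂ (z , y⇒z , fz≡b) = mex-excludes (f-mex (∈⇒≢[] y⇒z)) y⇒z (trans fz≡b b≡fy)
    below : ∀ j → j < toℕ b → j ∈ map f (moves x)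
    below j j<b = subst (_∈ _) (trans fy₀ (sym (<toℕ⇒≡toℕ-not b j<b))) (∈-map⁺ f x⇒y₀)

  special-from-options : ∀ {x} b → ¬ Terminal x → (∃ λ y → x ⇒ y × Special (not b) y) →
    (∀ {y} → x ⇒ y → Special (not b) y ⊎ ∃ λ z → y ⇒ z × Special b z) →
    Special b x
  special-from-options b ¬t (y₀ , x⇒y₀ , s₀) options =
      value-from-options 𝒢 (λ _ → 𝒢-mex _) b ¬t (y₀ , x⇒y₀ , proj₁ s₀)
                         (map-⊎ proj₁ (map₂ (map₂ proj₁)) ∘ options)
    , value-from-options 𝒢⁻ 𝒢⁻-mex (not b) ¬t (y₀ , x⇒y₀ , proj₂ s₀)
                         (map-⊎ proj₂ (map₂ (map₂ proj₂)) ∘ options)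

  𝒢⁻≡𝒢-from-swapped-options : ∀ {x} → ¬ Terminal x →
    (∀ {y} → x ⇒ y → ∃ λ y′ → x ⇒ y′ × 𝒢 y′ ≡ 𝒢⁻ y × 𝒢⁻ y′ ≡ 𝒢 y) →
    𝒢⁻ x ≡ 𝒢 x
  𝒢⁻≡𝒢-from-swapped-options {x} ¬t swap = IsMex-unique (𝒢⁻-mex ¬t) (absent , below)
    where
    absent : 𝒢 x ∉ map 𝒢⁻ (moves x)
    absent 𝒢x∈ with ∈-map⁻ 𝒢⁻ 𝒢x∈
    ... | y , x⇒y , 𝒢x≡𝒢⁻y with swap x⇒y
    ...   | y′ , x⇒y′ , 𝒢y′≡𝒢⁻y , _ = 𝒢-option x⇒y′ (trans 𝒢y′≡𝒢⁻y (sym 𝒢x≡𝒢⁻y))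
    below : ∀ j → j < 𝒢 x → j ∈ map 𝒢⁻ (moves x)
    below j j<𝒢x with mex-attains (𝒢-mex x) j<𝒢x
    ... | y , x⇒y , 𝒢y≡j with swap x⇒y
    ...   | y′ , x⇒y′ , _ , 𝒢⁻y′≡𝒢y = subst (_∈ _) (trans 𝒢⁻y′≡𝒢y 𝒢y≡j) (∈-map⁺ 𝒢⁻ x⇒y′)

  module _ (returnable : ReturnableG Γ) where

    returnable-V : ∀ b {x w} → x ⇒ w → ¬ Terminal w → V arena (toℕ b) (toℕ (not b)) x →
                   MovableTo arena w (V arena (toℕ b) (toℕ (not b)))
    returnable-V false x⇒w ¬t = proj₁ (returnable _ _ x⇒w ¬t)
    returnable-V true  x⇒w ¬t = proj₂ (returnable _ _ x⇒w ¬t)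

    return-to-special : ∀ {b x w} → Special b x → x ⇒ w → ¬ IsSpecial w →
                        ∃ λ w′ → w ⇒ w′ × Special b w′
    return-to-special {b} s x⇒w ¬sw
      with w′ , w⇒w′ , v ← returnable-V b x⇒w (λ t → ¬sw (false , terminal-special t)) (Special⇒V s)
      = w′ , w⇒w′ , V⇒Special b v

module Miserable (Γ : Game) (miserable : MiserableG Γ) where
  open Game Γ
  open SpragueGrundy Γ

  miserable-both-bits : ∀ {x w} → ¬ IsSpecial x → x ⇒ w → IsSpecial w →
                        ∀ b → ∃ λ w′ → x ⇒ w′ × Special b w′
  miserable-both-bits {x} {w} ¬sx x⇒w sw with miserable x
  ... | inj₁ v               = ⊥-elim (¬sx (V₀₁∪V₁₀⇒IsSpecial v))
  ... | inj₂ (inj₁ ¬movable) = ⊥-elim (¬movable (w , x⇒w , IsSpecial⇒V₀₁∪V₁₀ sw))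
  ... | inj₂ (inj₂ ((w₀ , x⇒w₀ , v₀) , (w₁ , x⇒w₁ , v₁))) = λ where
    false → w₀ , x⇒w₀ , V⇒Special false v₀
    true  → w₁ , x⇒w₁ , V⇒Special true v₁

  special⊎𝒢⁻≡𝒢 : ∀ x → IsSpecial x ⊎ 𝒢⁻ x ≡ 𝒢 x
  special⊎𝒢⁻≡𝒢 = induction _ step
    where
    step : ∀ x → (∀ {y} → x ⇒ y → IsSpecial y ⊎ 𝒢⁻ y ≡ 𝒢 y) → IsSpecial x ⊎ 𝒢⁻ x ≡ 𝒢 x
    step x ih with special? x | terminal? x
    ... | yes s  | _     = inj₁ s
    ... | no ¬s | yes t = ⊥-elim (¬s (false , terminal-special t))
    ... | no ¬s | no ¬t = inj₂ (𝒢⁻≡𝒢-from-swapped-options ¬t swap)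
      where
      swap : ∀ {y} → x ⇒ y → ∃ λ y′ → x ⇒ y′ × 𝒢 y′ ≡ 𝒢⁻ y × 𝒢⁻ y′ ≡ 𝒢 y
      swap x⇒y with ih x⇒y
      ... | inj₂ eq      = _ , x⇒y , sym eq , eq
      ... | inj₁ (b , s) with y′ , x⇒y′ , s′ ← miserable-both-bits ¬s x⇒y (b , s) (not b)
        = y′ , x⇒y′ , Special-swapped s s′

  special-option-if-𝒢⁻≢𝒢 : ∀ {b x w} → Special b x → x ⇒ w → 𝒢⁻ w ≢ 𝒢 w → Special (not b) w
  special-option-if-𝒢⁻≢𝒢 {w = w} s x⇒w 𝒢⁻w≢𝒢w with special⊎𝒢⁻≡𝒢 w
  ... | inj₁ (b′ , s′) = subst (λ c → Special c w) (special-move-flips s x⇒w s′) s′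
  ... | inj₂ 𝒢⁻w≡𝒢w   = ⊥-elim (𝒢⁻w≢𝒢w 𝒢⁻w≡𝒢w)

  special-option : ∀ {b x} → Special b x → ¬ Terminal x → ∃ λ w → x ⇒ w × Special (not b) w
  special-option {false} s@(𝒢x≡0 , 𝒢⁻x≡1) ¬t
    with w , x⇒w , 𝒢⁻w≡0 ← mex-attains (𝒢⁻-mex ¬t) (subst (0 <_) (sym 𝒢⁻x≡1) (s≤s z≤n))
    = w , x⇒w , special-option-if-𝒢⁻≢𝒢 s x⇒w λ 𝒢⁻w≡𝒢w →
        𝒢-option x⇒w (trans (sym 𝒢⁻w≡𝒢w) (trans 𝒢⁻w≡0 (sym 𝒢x≡0)))
  special-option {true} s@(𝒢x≡1 , 𝒢⁻x≡0) ¬t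
    with w , x⇒w , 𝒢w≡0 ← mex-attains (𝒢-mex _) (subst (0 <_) (sym 𝒢x≡1) (s≤s z≤n))
    = w , x⇒w , special-option-if-𝒢⁻≢𝒢 s x⇒w λ 𝒢⁻w≡𝒢w →
        mex-excludes (𝒢⁻-mex ¬t) x⇒w (trans 𝒢⁻w≡𝒢w (trans 𝒢w≡0 (sym 𝒢⁻x≡0)))

module _ {n} (Γ : Fin n → Game) where
  open Arena (Sum Γ) using () renaming (_⇒_ to _⇒ₛ_)

  sum-move-inv : ∀ {x y} → x ⇒ₛ y → ∃₂ λ i w → Game._⇒_ (Γ i) (x i) w × y ≡ update x i w
  sum-move-inv {x} x⇒y
    with i , y∈ ← satisfied (∈-concatMap⁻ (λ i → map (update x i) (Game.moves (Γ i) (x i)))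
                                          {xs = allFin n} x⇒y)
    with w , xᵢ⇒w , y≡ ← ∈-map⁻ (update x i) y∈
    = i , w , xᵢ⇒w , y≡

  update-move : ∀ {x i w} → Game._⇒_ (Γ i) (x i) w → x ⇒ₛ update x i w
  update-move {x} {i} xᵢ⇒w =
    ∈-concatMap⁺ (λ i → map (update x i) (Game.moves (Γ i) (x i))) {xs = allFin n}
                 (lose (∈-allFin i) (∈-map⁺ (update x i) xᵢ⇒w))

  sum-terminal : ∀ {x} → Arena.Terminal (Sum Γ) x → ∀ i → Game.Terminal (Γ i) (x i)
  sum-terminal {x} t i with Game.moves (Γ i) (x i) in moves≡
  ... | []    = refl
  ... | w ∷ _ = ⊥-elim (∈⇒≢[] (update-move (subst (w ∈_) (sym moves≡) (here refl))) t)

  private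
    Bounds : (Fin n → ℕ) → Arena.Pos (Sum Γ) → Set
    Bounds b x = ∀ i → Positions.Bounded (Γ i) (b i) (x i)

    Bounds-update : ∀ {b x i m w} → Bounds b x → Positions.Bounded (Γ i) m w →
                    Bounds (update b i m) (update x i w)
    Bounds-update {i = i} bounds bounded-w j with i Fin.≟ j
    ... | yes refl = bounded-w
    ... | no _     = bounds j

  -- The sum of coordinatewise bounds on the lengths of plays decreases along every move.
  sum-acc : ∀ b x → Bounds b x → Acc _<_ (sumᶠ b) → Acc (λ y x → x ⇒ₛ y) x
  sum-acc b x bounds (acc smaller) = acc next
    where
    next : ∀ {y} → x ⇒ₛ y → Acc (λ y x → x ⇒ₛ y) y
    next x⇒y with i , w , xᵢ⇒w , refl ← sum-move-inv x⇒y with b i in bᵢ≡ | bounds i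
    ... | zero  | bounded-xᵢ = ⊥-elim (bounded-xᵢ xᵢ⇒w)
    ... | suc m | bounded-xᵢ =
      sum-acc (update b i m) (update x i w) (Bounds-update bounds (bounded-xᵢ xᵢ⇒w))
              (smaller (sumᶠ-decrease i (λ j → update-other b m) mᵢ<bᵢ))
      where
      mᵢ<bᵢ : update b i m i < b i
      mᵢ<bᵢ rewrite update-same b i m | bᵢ≡ = ≤-refl

  sum-wellFounded : WellFounded (λ y x → x ⇒ₛ y)
  sum-wellFounded x = sum-acc (proj₁ ∘ bounds) x (proj₂ ∘ bounds) (<-wellFounded _)
    where bounds = λ i → Positions.bounded (Γ i) (x i)

SumGame : ∀ {n} → (Fin n → Game) → Game
SumGame Γ = record { arena = Sum Γ ; wf = sum-wellFounded Γ }

module MiserableReturnableSum {n} (Γ : Fin n → Game)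
         (miserable : ∀ i → MiserableG (Γ i)) (returnable : ∀ i → ReturnableG (Γ i)) where
  open Game (SumGame Γ)
  open SpragueGrundy (SumGame Γ)

  module C (i : Fin n) where
    open SpragueGrundy (Γ i) public
    open Miserable (Γ i) (miserable i) public

  AllSpecial : Pos → Set
  AllSpecial x = ∀ i → C.IsSpecial i (x i)

  allSpecial? : ∀ x → Dec (AllSpecial x)
  allSpecial? x = all? (λ i → C.special? i (x i))

  σ : Pos → Bool
  σ x = parity (λ i → C.bit i (x i))

  AllSpecial-from : ∀ {x} i → (∀ j → i ≢ j → C.IsSpecial j (x j)) → C.IsSpecial i (x i) → AllSpecial x
  AllSpecial-from i others sᵢ j with i Fin.≟ j
  ... | yes refl = sᵢ
  ... | no i≢j   = others j i≢j

  AllSpecial-update : ∀ {x i w} → (∀ j → i ≢ j → C.IsSpecial j (x j)) → C.IsSpecial i w →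
                      AllSpecial (update x i w)
  AllSpecial-update {x} {i} {w} others sw =
    AllSpecial-from i (λ j i≢j → subst (C.IsSpecial j) (sym (update-other x w i≢j)) (others j i≢j))
                      (subst (C.IsSpecial i) (sym (update-same x i w)) sw)

  AllSpecial-others : ∀ {x i w} → AllSpecial (update x i w) → ∀ j → i ≢ j → C.IsSpecial j (x j)
  AllSpecial-others {x} {w = w} all j i≢j = subst (C.IsSpecial j) (update-other x w i≢j) (all j)

  Special-update : ∀ {x i b w} → C.Special i b w → C.Special i b (update x i w i)
  Special-update {x} {i} {w = w} = subst (C.Special i _) (sym (update-same x i w))

  σ-flip : ∀ {x x′ b} i → (∀ j → i ≢ j → x′ j ≡ x j) →
           C.Special i b (x i) → C.Special i (not b) (x′ i) → σ x′ ≡ not (σ x)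
  σ-flip i same s s′ = parity-flip i (λ j i≢j → cong (C.bit j) (same j i≢j))
                                     (trans (C.Special⇒bit i s′) (cong not (sym (C.Special⇒bit i s))))

  σ-keep : ∀ {x x′ b} i → (∀ j → i ≢ j → x′ j ≡ x j) →
           C.Special i b (x i) → C.Special i b (x′ i) → σ x′ ≡ σ x
  σ-keep {x} {x′} i same s s′ = parity-cong bits-agree
    where
    bits-agree : ∀ j → C.bit j (x′ j) ≡ C.bit j (x j)
    bits-agree j with i Fin.≟ j
    ... | yes refl = trans (C.Special⇒bit i s′) (sym (C.Special⇒bit i s))
    ... | no i≢j   = cong (C.bit j) (same j i≢j)

  σ-terminal : ∀ {x} → Terminal x → σ x ≡ false
  σ-terminal t = parity-false λ i → C.Special⇒bit i (C.terminal-special i (sum-terminal Γ t i))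

  flip-move : ∀ {x i b w} → AllSpecial x → C.Special i b (x i) → C.Special i (not b) w →
              AllSpecial (update x i w) × σ (update x i w) ≡ not (σ x)
  flip-move {x} {i} {w = w} all sᵢ s =
    AllSpecial-update (λ j _ → all j) (_ , s) , σ-flip i (λ j → update-other x w) sᵢ (Special-update s)

  return-move : ∀ {x i b w} → AllSpecial x → C.Special i b (x i) → Game._⇒_ (Γ i) (x i) w →
                ¬ C.IsSpecial i w → ∃ λ z → update x i w ⇒ z × AllSpecial z × σ z ≡ σ x
  return-move {x} {i} {b} {w} all sᵢ xᵢ⇒w ¬sw
    with w′ , w⇒w′ , s′ ← C.return-to-special i (returnable i) sᵢ xᵢ⇒w ¬sw
    = update y i w′
    , update-move Γ (subst (λ u → Game._⇒_ (Γ i) u w′) (sym (update-same x i w)) w⇒w′)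
    , AllSpecial-update (λ j i≢j → subst (C.IsSpecial j) (sym (update-other x w i≢j)) (all j)) (b , s′)
    , σ-keep i (λ j i≢j → trans (update-other y w′ i≢j) (update-other x w i≢j)) sᵢ (Special-update s′)
    where
    y = update x i w

  special-step : ∀ {x} → AllSpecial x → ¬ Terminal x → ∃ λ y → x ⇒ y × AllSpecial y × σ y ≡ not (σ x)
  special-step all ¬t
    with y , x⇒y ← ¬Terminal⇒move ¬t
    with i , w , xᵢ⇒w , refl ← sum-move-inv Γ x⇒y
    with b , sᵢ ← all i
    with w′ , xᵢ⇒w′ , s′ ← C.special-option i sᵢ (∈⇒≢[] xᵢ⇒w)
    = _ , update-move Γ xᵢ⇒w′ , flip-move all sᵢ s′

  allSpecial-option : ∀ {x y} → AllSpecial x → x ⇒ y →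
                      (AllSpecial y × σ y ≡ not (σ x)) ⊎ ∃ λ z → y ⇒ z × AllSpecial z × σ z ≡ σ x
  allSpecial-option all x⇒y with i , w , xᵢ⇒w , refl ← sum-move-inv Γ x⇒y with b , sᵢ ← all i
                                 with C.special? i w
  ... | yes (b′ , s′) =
    inj₁ (flip-move all sᵢ (subst (λ c → C.Special i c w) (C.special-move-flips i sᵢ xᵢ⇒w s′) s′))
  ... | no ¬sw        = inj₂ (return-move all sᵢ xᵢ⇒w ¬sw)

  mixed-opposite-option : ∀ {x y} → ¬ AllSpecial x → x ⇒ y → AllSpecial y →
                          ∃ λ y′ → x ⇒ y′ × AllSpecial y′ × σ y′ ≡ not (σ y)
  mixed-opposite-option {x} ¬all x⇒y all-y with i , w , xᵢ⇒w , refl ← sum-move-inv Γ x⇒y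
    with b , s ← subst (C.IsSpecial i) (update-same x i w) (all-y i)
    with w′ , xᵢ⇒w′ , s′ ← C.miserable-both-bits i (¬all ∘ AllSpecial-from i (AllSpecial-others all-y))
                                                 xᵢ⇒w (b , s) (not b)
    = update x i w′ , update-move Γ xᵢ⇒w′ , AllSpecial-update (AllSpecial-others all-y) (not b , s′)
    , σ-flip i (λ j i≢j → trans (update-other x w′ i≢j) (sym (update-other x w i≢j)))
               (Special-update s) (Special-update s′)

  Values : Pos → Set
  Values x = (AllSpecial x → Special (σ x) x) × (¬ AllSpecial x → 𝒢⁻ x ≡ 𝒢 x)

  special-at : ∀ {x b} → Values x → AllSpecial x → σ x ≡ b → Special b x
  special-at values all σx≡b = subst (λ c → Special c _) σx≡b (proj₁ values all)

  allSpecial⇒Special : ∀ {x} → (∀ {y} → x ⇒ y → Values y) → (∀ {y z} → x ⇒ y → y ⇒ z → Values z) →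
                       AllSpecial x → Special (σ x) x
  allSpecial⇒Special {x} ih ih₂ all with terminal? x
  ... | yes t  = subst (λ c → Special c x) (sym (σ-terminal t)) (terminal-special t)
  ... | no ¬t with y₀ , x⇒y₀ , all₀ , σy₀ ← special-step all ¬t
    = special-from-options (σ x) ¬t (y₀ , x⇒y₀ , special-at (ih x⇒y₀) all₀ σy₀) option
    where
    option : ∀ {y} → x ⇒ y → Special (not (σ x)) y ⊎ ∃ λ z → y ⇒ z × Special (σ x) z
    option x⇒y with allSpecial-option all x⇒y
    ... | inj₁ (all-y , σy)           = inj₁ (special-at (ih x⇒y) all-y σy)
    ... | inj₂ (z , y⇒z , all-z , σz) = inj₂ (z , y⇒z , special-at (ih₂ x⇒y y⇒z) all-z σz)

  mixed⇒𝒢⁻≡𝒢 : ∀ {x} → (∀ {y} → x ⇒ y → Values y) → ¬ AllSpecial x → 𝒢⁻ x ≡ 𝒢 x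
  mixed⇒𝒢⁻≡𝒢 {x} ih ¬all with terminal? x
  ... | yes t  = ⊥-elim (¬all λ i → false , C.terminal-special i (sum-terminal Γ t i))
  ... | no ¬t = 𝒢⁻≡𝒢-from-swapped-options ¬t swap
    where
    swap : ∀ {y} → x ⇒ y → ∃ λ y′ → x ⇒ y′ × 𝒢 y′ ≡ 𝒢⁻ y × 𝒢⁻ y′ ≡ 𝒢 y
    swap {y} x⇒y with allSpecial? y
    ... | no ¬all-y = y , x⇒y , sym (proj₂ (ih x⇒y) ¬all-y) , proj₂ (ih x⇒y) ¬all-y
    ... | yes all-y with y′ , x⇒y′ , all-y′ , σy′ ← mixed-opposite-option ¬all x⇒y all-y
      = y′ , x⇒y′ , Special-swapped (proj₁ (ih x⇒y) all-y) (special-at (ih x⇒y′) all-y′ σy′)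

  values : ∀ x → Values x
  values = induction₂ Values λ x ih ih₂ → allSpecial⇒Special ih ih₂ , mixed⇒𝒢⁻≡𝒢 ih

  special-returns : ∀ {b x y} → Special b x → x ⇒ y → ¬ Terminal y → ∃ λ z → y ⇒ z × Special b z
  special-returns {b} {x} {y} (𝒢x≡b , 𝒢⁻x≡¬b) x⇒y ¬t-y with allSpecial? x
  ... | no ¬all = ⊥-elim (toℕ-not-≢ b (trans (sym 𝒢⁻x≡¬b) (trans (proj₂ (values x) ¬all) 𝒢x≡b)))
  ... | yes all with σx≡b ← Special-unique (proj₁ (values x) all) (𝒢x≡b , 𝒢⁻x≡¬b)
                with allSpecial-option all x⇒y
  ... | inj₂ (z , y⇒z , all-z , σz≡σx) = z , y⇒z , special-at (values z) all-z (trans σz≡σx σx≡b)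
  ... | inj₁ (all-y , σy≡¬σx) with z , y⇒z , all-z , σz≡¬σy ← special-step all-y ¬t-y
    = z , y⇒z , special-at (values z) all-z (begin
        σ z             ≡⟨ σz≡¬σy ⟩
        not (σ y)       ≡⟨ cong not σy≡¬σx ⟩
        not (not (σ x)) ≡⟨ not-involutive (σ x) ⟩
        σ x             ≡⟨ σx≡b ⟩
        b               ∎)
    where open ≡-Reasoning

  sum-returnable : Returnable (Sum Γ)
  sum-returnable x y x⇒y ¬t-y = returns false , returns true
    where
    returns : ∀ b → V (Sum Γ) (toℕ b) (toℕ (not b)) x →
              MovableTo (Sum Γ) y (V (Sum Γ) (toℕ b) (toℕ (not b)))
    returns b v with z , y⇒z , s ← special-returns (V⇒Special b v) x⇒y ¬t-y = z , y⇒z , Special⇒V s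

proposition5p5 : (n : ℕ) → n ≥ 2 → (G : Fin n → Game) →
                 (∀ i → MiserableG (G i)) → (∀ i → ReturnableG (G i)) →
                 Returnable (Sum G)
proposition5p5 n _ G miserable returnable = MiserableReturnableSum.sum-returnable G miserable returnable
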